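{- Let $G=(V,E)$ be a directed graph with positive edge weights, $n=|V|$, and let $d>0$ be an even integer. Let $H$ be a $(1+\epsilon)^q$-approximate $d$-hub set of $G$ (for some $q\ge0$). Let $\mathcal{T}^{\mathrm{from}}=\{T^{\mathrm{from}}_v: v\in H\}$ (respectively $\mathcal{T}^{\mathrm{to}}=\{T^{\mathrm{to}}_v: v\in H\}$) be a collection of $(1+\epsilon)$-approximate shortest path trees up to depth $3d$ from the vertices of $H$ in $G$ (respectively in $\overleftarrow{G}$). Let $B\subseteq V$ be a $(\mathcal{T}^{\mathrm{from}}\cup \mathcal{T}^{\mathrm{to}},\frac{d}{2})$-blocker set. Then $B$ is a $(1+\epsilon)^{p+q-1}$-approximate $2dp$-hub set of $G$, where $p=\lceil\log_2{n}\rceil+1$.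
   Context: $\overleftarrow{G}$ reverses every edge keeping weights. $\ell(P)$ is the sum of edge weights, $|P|$ the number of edges; $\delta_G(u,v)$ is the shortest path length and $\delta^k_G(u,v)$ the minimum length of a $u\to v$ path with at most $k$ edges. An out-tree $T\subseteq G$ rooted at $s$ is a $(1+\epsilon)$-approximate shortest path tree from $s$ up to depth $k$ if for every $v$ with $\delta^{k}_G(s,v)<\infty$, $v\in V(T)$ and $\delta_T(s,v)\le(1+\epsilon)\delta^{k}_G(s,v)$. For a rooted tree $T$ and integer $k>0$, $B$ is a $(T,k)$-blocker set if for every non-leaf $x\in V(T)$ with depth divisible by $k$ and every descendant $y$ of $x$ at depth $\mathrm{depth}(x)+k$, some vertex on the tree path from $x$ to $y$ (inclusive) is in $B$; for a collection this must hold for each tree. A path is $(S,k)$-covered if it equals $P_1\cdots P_r$ with $P_i$ a $u_i\to v_i$ path with at most $k$ edges and $u_i\in S$ for $i\ge2$. For $\alpha\ge1$, a set $S$ is an $\alpha$-approximate $k$-hub set of $G$ if for all $u,v$ with $\delta_G(u,v)<\infty$ there is a $u\to v$ path $P$ in $G$ with $\ell(P)\le\alpha\,\delta_G(u,v)$ that is $(S,k)$-covered.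
   Formalization: The positive edge weights and the parameter ε are taken to be rationals instead of real numbers. -}

module Defs where

open import Data.Nat as ℕ using (ℕ; zero; suc)
open import Data.Fin using (Fin)
open import Data.Fin.Subset using (Subset; _∈_)
open import Data.Rational as ℚ using (ℚ; 0ℚ; 1ℚ)
open import Data.List as List using (List; _∷_; [])
open import Data.List.Membership.Propositional renaming (_∈_ to _∈ˡ_)
open import Data.Product using (Σ; ∃; _×_; _,_; proj₁; proj₂)
open import Data.Sum using (_⊎_)
open import Data.Maybe using (Maybe; just; nothing)
open import Data.Nat.Divisibility using (_∣_)
open import Relation.Binary.PropositionalEquality using (_≡_)

-- Weighted directed (multi)graphs on vertex set Fin n.
-- An edge (u , v , w) goes from u to v with weight w.

Edge : ℕ → Set
Edge n = Fin n × Fin n × ℚ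

record Graph (n : ℕ) : Set where
  field
    edges : List (Edge n)
open Graph public

PositiveWeights : ∀ {n} → Graph n → Set
PositiveWeights G = ∀ {u v w} → (u , v , w) ∈ˡ edges G → 0ℚ ℚ.< w

rev : ∀ {n} → Graph n → Graph n
rev G = record { edges = List.map (λ { (u , v , w) → (v , u , w) }) (edges G) }

_^ℚ_ : ℚ → ℕ → ℚ
x ^ℚ zero  = 1ℚ
x ^ℚ suc k = x ℚ.* (x ^ℚ k)

data Path {n} (G : Graph n) : Fin n → Fin n → Set where
  []  : ∀ {u} → Path G u u
  _∷_ : ∀ {u m v w} → (u , m , w) ∈ˡ edges G → Path G m v → Path G u v

len : ∀ {n} {G : Graph n} {u v} → Path G u v → ℚ
len [] = 0ℚ
len (_∷_ {w = w} _ P) = w ℚ.+ len P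

size : ∀ {n} {G : Graph n} {u v} → Path G u v → ℕ
size [] = 0
size (_ ∷ P) = suc (size P)

_++ᵖ_ : ∀ {n} {G : Graph n} {u m v} → Path G u m → Path G m v → Path G u v
[] ++ᵖ Q = Q
(e ∷ P) ++ᵖ Q = e ∷ (P ++ᵖ Q)

Reachable : ∀ {n} → Graph n → Fin n → Fin n → Set
Reachable G u v = Path G u v

ReachableWithin : ∀ {n} → Graph n → ℕ → Fin n → Fin n → Set
ReachableWithin G k u v = Σ (Path G u v) λ P → size P ℕ.≤ k

data Covered {n} {G : Graph n} (S : Subset n) (k : ℕ) :
             ∀ {u v} → Path G u v → Set where
  last : ∀ {u v} (P : Path G u v) → size P ℕ.≤ k → Covered S k P
  more : ∀ {u m v} (P : Path G u m) (Q : Path G m v) →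
         size P ℕ.≤ k → m ∈ S → Covered S k Q → Covered S k (P ++ᵖ Q)

-- α-approximate k-hub set.  ℓ(Q) ≤ α δ_G(u,v) is written as
-- ℓ(Q) ≤ α ℓ(P) for every u → v path P (δ_G is the minimum over such P).
IsApproxHubSet : ∀ {n} → Graph n → ℚ → ℕ → Subset n → Set
IsApproxHubSet G α k S =
  ∀ u v → Reachable G u v →
  Σ (Path G u v) λ Q → Covered S k Q × (∀ (P : Path G u v) → len Q ℚ.≤ α ℚ.* len P)

-- Out-trees T ⊆ G rooted at s, given by parent pointers and depths.
-- par v = just (u , w , e) means the tree edge into v is e : (u,v,w) ∈ E(G).

ParentEdge : ∀ {n} → Graph n → Fin n → Set
ParentEdge {n} G v = Σ (Fin n) λ u → Σ ℚ λ w → (u , v , w) ∈ˡ edges G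

record OutTree {n} (G : Graph n) (s : Fin n) : Set where
  field
    par   : (v : Fin n) → Maybe (ParentEdge G v)
    depth : Fin n → ℕ
  InT : Fin n → Set
  InT v = v ≡ s ⊎ Σ (ParentEdge G v) λ pe → par v ≡ just pe
  field
    par-root    : par s ≡ nothing
    depth-root  : depth s ≡ 0
    par-inT     : ∀ v u w e → par v ≡ just (u , w , e) → InT u
    par-depth   : ∀ v u w e → par v ≡ just (u , w , e) → depth v ≡ suc (depth u)
open OutTree public

data TPath {n} {G : Graph n} {s} (T : OutTree G s) (x : Fin n) : Fin n → Set where
  here : InT T x → TPath T x x
  down : ∀ {u v w e} → TPath T x u → par T v ≡ just (u , w , e) → TPath T x v

verts : ∀ {n} {G : Graph n} {s} {T : OutTree G s} {x y} → TPath T x y → List (Fin n)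
verts {x = x} (here _) = x ∷ []
verts {y = y} (down p _) = y ∷ verts p

tlen : ∀ {n} {G : Graph n} {s} {T : OutTree G s} {x y} → TPath T x y → ℚ
tlen (here _) = 0ℚ
tlen (down {w = w} p _) = tlen p ℚ.+ w

NonLeaf : ∀ {n} {G : Graph n} {s} → OutTree G s → Fin n → Set
NonLeaf {n} {G} T x = Σ (Fin n) λ v → Σ ℚ λ w → Σ ((x , v , w) ∈ˡ edges G) λ e →
                        par T v ≡ just (x , w , e)

IsApproxSPT : ∀ {n} {G : Graph n} {s} → ℚ → ℕ → OutTree G s → Set
IsApproxSPT {G = G} {s} ε k T =
  ∀ v → ReachableWithin G k s v →
  InT T v × Σ (TPath T s v) λ t →
    ∀ (P : Path G s v) → size P ℕ.≤ k → tlen t ℚ.≤ (1ℚ ℚ.+ ε) ℚ.* len P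

IsBlocker : ∀ {n} {G : Graph n} {s} → OutTree G s → ℕ → Subset n → Set
IsBlocker T k B =
  ∀ x y → InT T x → NonLeaf T x → k ∣ depth T x →
  (p : TPath T x y) → depth T y ≡ depth T x ℕ.+ k →
  Σ _ λ z → z ∈ˡ verts p × z ∈ B

-- Take the path Q promised by the hub set H.  After its first piece it is a chain of segments of
-- at most d edges, each starting at a hub; cutting out the cycles between repeated hubs leaves at
-- most n ≤ 2^L segments, where L = ⌈log₂ n⌉.  These are merged pairwise in L rounds.  When both
-- halves are still a single segment, their concatenation has at most 2d ≤ 3d edges and starts at a
-- hub, so the approximate shortest path tree of that hub reaches its end by a tree path at most
-- 1+ε times longer, and the blocker set cuts every tree path from the root into pieces of at most
-- d edges, each starting in B.  Otherwise the two B-segmentations are concatenated, fusing one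
-- pair of adjacent pieces.  Each round costs one factor 1+ε and lengthens the outer pieces by at
-- most d edges, so after L rounds, even with the first piece of Q prepended, every piece has at
-- most 2(L+1)d edges.

module Submission where

open import Defs
open import Data.Nat using (ℕ; zero; suc; _+_; _∸_; _*_; _^_; _≤_; _<_; _/_; z≤n; s≤s; ⌈_/2⌉; >-nonZero)
open import Data.Nat.Properties
open import Data.Nat.Divisibility using (_∣_; divides; ∣m∣n⇒∣m+n; ∣-refl)
open import Data.Nat.DivMod using (m/n*n≡m)
open import Data.Nat.Logarithm using (⌈log₂_⌉)
open import Data.Nat.Logarithm.Core using (⌈log2⌉)
open import Data.Nat.Solver using (module +-*-Solver)
open import Data.Rational as ℚ using (ℚ; 0ℚ; 1ℚ)
import Data.Rational.Properties as ℚₚ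
open import Data.Fin as Fin using (Fin)
open import Data.Fin.Properties using (injective⇒≤) renaming (_≟_ to _≟ᶠ_)
open import Data.Fin.Subset using (Subset; _∈_)
open import Data.List using (List; []; _∷_; length; lookup)
open import Data.List.Membership.Propositional renaming (_∈_ to _∈ˡ_)
open import Data.List.Membership.Propositional.Properties using (∈-lookup)
open import Data.List.Relation.Unary.Any using (here; there; any?)
import Data.List.Relation.Unary.All as All
open import Data.List.Relation.Unary.All.Properties using (¬Any⇒All¬)
open import Data.List.Relation.Unary.AllPairs using ([]; _∷_)
open import Data.List.Relation.Unary.Unique.Propositional using (Unique)
open import Data.Product using (Σ; _×_; _,_; proj₁)
open import Data.Sum using (inj₁; inj₂)
open import Data.Maybe using (just)
open import Data.Empty using (⊥; ⊥-elim)
open import Data.Unit using (⊤; tt)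
open import Function.Definitions using (Injective)
open import Induction.WellFounded using (Acc; acc)
open import Relation.Nullary using (yes; no; ¬_)
open import Relation.Binary.PropositionalEquality

halve : ∀ m t → m ≤ t + t → Σ ℕ λ m₁ → m₁ ≤ m × m₁ ≤ t × m ∸ m₁ ≤ t
halve m t m≤2t with ≤-total m t
... | inj₁ m≤t = m , ≤-refl , m≤t , ≤-trans (m∸n≤m m m) m≤t
... | inj₂ t≤m = t , t≤m , ≤-refl , ≤-trans (∸-monoˡ-≤ t m≤2t) (≤-reflexive (m+n∸n≡m t t))

n≤2^⌈log₂n⌉ : ∀ n → n ≤ 2 ^ ⌈log₂ n ⌉
n≤2^⌈log₂n⌉ n = go n _
  where
  n≤⌈n/2⌉+⌈n/2⌉ : ∀ m → m ≤ ⌈ m /2⌉ + ⌈ m /2⌉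
  n≤⌈n/2⌉+⌈n/2⌉ m = ≤-trans (≤-reflexive (sym (⌊n/2⌋+⌈n/2⌉≡n m))) (+-monoˡ-≤ ⌈ m /2⌉ (⌊n/2⌋≤⌈n/2⌉ m))
  go : ∀ m (rec : Acc _<_ m) → m ≤ 2 ^ ⌈log2⌉ m rec
  go zero          _        = z≤n
  go (suc zero)    _        = s≤s z≤n
  go (suc (suc m)) (acc rs) = begin
    suc (suc m)                ≤⟨ n≤⌈n/2⌉+⌈n/2⌉ (suc (suc m)) ⟩
    suc ⌈ m /2⌉ + suc ⌈ m /2⌉  ≤⟨ +-mono-≤ ih ih ⟩
    2 ^ L′ + 2 ^ L′            ≡⟨ cong (2 ^ L′ +_) (sym (+-identityʳ (2 ^ L′))) ⟩
    2 ^ suc L′                 ∎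
    where
    open ≤-Reasoning
    L′ = ⌈log2⌉ (suc ⌈ m /2⌉) (rs (⌈n/2⌉<n m))
    ih = go (suc ⌈ m /2⌉) (rs (⌈n/2⌉<n m))

Unique⇒length≤ : ∀ {n} {xs : List (Fin n)} → Unique xs → length xs ≤ n
Unique⇒length≤ unique = injective⇒≤ (lookup-injective unique)
  where
  lookup-injective : ∀ {xs : List (Fin _)} → Unique xs → Injective _≡_ _≡_ (lookup xs)
  lookup-injective (_  ∷ _)      {Fin.zero}  {Fin.zero}  _  = refl
  lookup-injective (x∉ ∷ _)      {Fin.zero}  {Fin.suc j} eq = ⊥-elim (All.lookup x∉ (∈-lookup j) eq)
  lookup-injective (x∉ ∷ _)      {Fin.suc i} {Fin.zero}  eq = ⊥-elim (All.lookup x∉ (∈-lookup i) (sym eq))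
  lookup-injective (_  ∷ unique) {Fin.suc i} {Fin.suc j} eq = cong Fin.suc (lookup-injective unique eq)

1≤p⇒0≤p : ∀ {p} → 1ℚ ℚ.≤ p → 0ℚ ℚ.≤ p
1≤p⇒0≤p = ℚₚ.≤-trans (ℚₚ.nonNegative⁻¹ 1ℚ)

*-monoˡ-≤-nonNeg : ∀ r {p q} → 0ℚ ℚ.≤ r → p ℚ.≤ q → r ℚ.* p ℚ.≤ r ℚ.* q
*-monoˡ-≤-nonNeg r 0≤r = ℚₚ.*-monoˡ-≤-nonNeg r {{ℚ.nonNegative 0≤r}}

*-nonNeg : ∀ {p q} → 0ℚ ℚ.≤ p → 0ℚ ℚ.≤ q → 0ℚ ℚ.≤ p ℚ.* q
*-nonNeg {p} 0≤p 0≤q = ℚₚ.≤-trans (ℚₚ.≤-reflexive (sym (ℚₚ.*-zeroʳ p))) (*-monoˡ-≤-nonNeg p 0≤p 0≤q)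

p≤r*p : ∀ {r p} → 1ℚ ℚ.≤ r → 0ℚ ℚ.≤ p → p ℚ.≤ r ℚ.* p
p≤r*p {p = p} 1≤r 0≤p =
  ℚₚ.≤-trans (ℚₚ.≤-reflexive (sym (ℚₚ.*-identityˡ p))) (ℚₚ.*-monoʳ-≤-nonNeg p {{ℚ.nonNegative 0≤p}} 1≤r)

p≤q+p : ∀ {p q} → 0ℚ ℚ.≤ q → p ℚ.≤ q ℚ.+ p
p≤q+p {p} 0≤q = ℚₚ.≤-trans (ℚₚ.≤-reflexive (sym (ℚₚ.+-identityˡ p))) (ℚₚ.+-monoˡ-≤ p 0≤q)

+-mono-*ˡ-≤ : ∀ r {p q x y} → p ℚ.≤ r ℚ.* x → q ℚ.≤ r ℚ.* y → p ℚ.+ q ℚ.≤ r ℚ.* (x ℚ.+ y)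
+-mono-*ˡ-≤ r {x = x} {y} p≤ q≤ =
  ℚₚ.≤-trans (ℚₚ.+-mono-≤ p≤ q≤) (ℚₚ.≤-reflexive (sym (ℚₚ.*-distribˡ-+ r x y)))

^ℚ-distribˡ-+-* : ∀ r i j → r ^ℚ (i + j) ≡ r ^ℚ i ℚ.* r ^ℚ j
^ℚ-distribˡ-+-* r zero    j = sym (ℚₚ.*-identityˡ _)
^ℚ-distribˡ-+-* r (suc i) j = trans (cong (r ℚ.*_) (^ℚ-distribˡ-+-* r i j)) (sym (ℚₚ.*-assoc r _ _))

module _ {r : ℚ} (1≤r : 1ℚ ℚ.≤ r) where

  1≤^ℚ : ∀ j → 1ℚ ℚ.≤ r ^ℚ j
  1≤^ℚ zero    = ℚₚ.≤-refl
  1≤^ℚ (suc j) = ℚₚ.≤-trans (1≤^ℚ j) (p≤r*p 1≤r (1≤p⇒0≤p (1≤^ℚ j)))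

  0≤^ℚ : ∀ j → 0ℚ ℚ.≤ r ^ℚ j
  0≤^ℚ j = 1≤p⇒0≤p (1≤^ℚ j)

  ^ℚ-monoˡ-* : ∀ {p i j} → 0ℚ ℚ.≤ p → i ≤ j → r ^ℚ i ℚ.* p ℚ.≤ r ^ℚ j ℚ.* p
  ^ℚ-monoˡ-* {p} {i} 0≤p i≤j with m≤n⇒∃[o]m+o≡n i≤j
  ... | o , refl = begin
    r ^ℚ i ℚ.* p               ≤⟨ p≤r*p (1≤^ℚ o) (*-nonNeg (0≤^ℚ i) 0≤p) ⟩
    r ^ℚ o ℚ.* (r ^ℚ i ℚ.* p)  ≡⟨ sym (ℚₚ.*-assoc (r ^ℚ o) (r ^ℚ i) p) ⟩
    r ^ℚ o ℚ.* r ^ℚ i ℚ.* p    ≡⟨ cong (ℚ._* p) (sym (^ℚ-distribˡ-+-* r o i)) ⟩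
    r ^ℚ (o + i) ℚ.* p         ≡⟨ cong (λ e → r ^ℚ e ℚ.* p) (+-comm o i) ⟩
    r ^ℚ (i + o) ℚ.* p         ∎
    where open ℚₚ.≤-Reasoning

module _ {n : ℕ} {G : Graph n} where

  ++ᵖ-assoc : ∀ {a b c d} (P : Path G a b) (Q : Path G b c) (R : Path G c d) →
              (P ++ᵖ Q) ++ᵖ R ≡ P ++ᵖ (Q ++ᵖ R)
  ++ᵖ-assoc []      Q R = refl
  ++ᵖ-assoc (e ∷ P) Q R = cong (e ∷_) (++ᵖ-assoc P Q R)

  ++ᵖ-identityʳ : ∀ {a b} (P : Path G a b) → P ++ᵖ [] ≡ P
  ++ᵖ-identityʳ []      = refl
  ++ᵖ-identityʳ (e ∷ P) = cong (e ∷_) (++ᵖ-identityʳ P)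

  size-++ᵖ : ∀ {a b c} (P : Path G a b) (Q : Path G b c) → size (P ++ᵖ Q) ≡ size P + size Q
  size-++ᵖ []      Q = refl
  size-++ᵖ (e ∷ P) Q = cong suc (size-++ᵖ P Q)

  size-++ᵖ-≤ : ∀ {a b c k} (P : Path G a b) (Q : Path G b c) → size P + size Q ≤ k → size (P ++ᵖ Q) ≤ k
  size-++ᵖ-≤ P Q = subst (_≤ _) (sym (size-++ᵖ P Q))

  len-++ᵖ : ∀ {a b c} (P : Path G a b) (Q : Path G b c) → len (P ++ᵖ Q) ≡ len P ℚ.+ len Q
  len-++ᵖ []                Q = sym (ℚₚ.+-identityˡ (len Q))
  len-++ᵖ (_∷_ {w = w} e P) Q = trans (cong (w ℚ.+_) (len-++ᵖ P Q)) (sym (ℚₚ.+-assoc w (len P) (len Q)))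

  len-nonNeg : PositiveWeights G → ∀ {a b} (P : Path G a b) → 0ℚ ℚ.≤ len P
  len-nonNeg pos []      = ℚₚ.≤-refl
  len-nonNeg pos (e ∷ P) = ℚₚ.+-mono-≤ (ℚₚ.<⇒≤ (pos e)) (len-nonNeg pos P)

module Segmentation {n : ℕ} (G : Graph n) (B : Subset n) where

  private variable x y z : Fin n

  infixr 5 _∷⟨_⟩_ _++ˢ_

  data Segments : Fin n → Fin n → Set where
    [_]    : Path G x y → Segments x y
    _∷⟨_⟩_ : Path G x z → z ∈ B → Segments z y → Segments x y

  concat : Segments x y → Path G x y
  concat [ P ]          = P
  concat (P ∷⟨ _ ⟩ σ) = P ++ᵖ concat σ

  headSize : Segments x y → ℕ
  headSize [ P ]          = size P
  headSize (P ∷⟨ _ ⟩ _) = size P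

  lastSize : Segments x y → ℕ
  lastSize [ P ]          = size P
  lastSize (_ ∷⟨ _ ⟩ σ) = lastSize σ

  AllWithin : ℕ → Segments x y → Set
  AllWithin k [ P ]          = size P ≤ k
  AllWithin k (P ∷⟨ _ ⟩ σ) = size P ≤ k × AllWithin k σ

  IsSingle : Segments x y → Set
  IsSingle [ _ ]          = ⊤
  IsSingle (_ ∷⟨ _ ⟩ _) = ⊥

  _++ˢ_ : Segments x y → Segments y z → Segments x z
  [ P ]          ++ˢ [ Q ]          = [ P ++ᵖ Q ]
  [ P ]          ++ˢ (Q ∷⟨ b ⟩ τ) = (P ++ᵖ Q) ∷⟨ b ⟩ τ
  (P ∷⟨ b ⟩ σ) ++ˢ τ              = P ∷⟨ b ⟩ (σ ++ˢ τ)

  concat-++ˢ : (σ : Segments x y) (τ : Segments y z) → concat (σ ++ˢ τ) ≡ concat σ ++ᵖ concat τ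
  concat-++ˢ [ P ]          [ Q ]          = refl
  concat-++ˢ [ P ]          (Q ∷⟨ _ ⟩ τ) = ++ᵖ-assoc P Q (concat τ)
  concat-++ˢ (P ∷⟨ _ ⟩ σ) τ              =
    trans (cong (P ++ᵖ_) (concat-++ˢ σ τ)) (sym (++ᵖ-assoc P (concat σ) (concat τ)))

  IsSingle-++ˢ : (σ : Segments x y) (τ : Segments y z) → IsSingle (σ ++ˢ τ) → IsSingle σ × IsSingle τ
  IsSingle-++ˢ [ _ ] [ _ ] _ = tt , tt

  AllWithin-mono : ∀ {k k′} → k ≤ k′ → (σ : Segments x y) → AllWithin k σ → AllWithin k′ σ
  AllWithin-mono k≤k′ [ P ]          P≤k         = ≤-trans P≤k k≤k′
  AllWithin-mono k≤k′ (P ∷⟨ _ ⟩ σ) (P≤k , σ≤k) = ≤-trans P≤k k≤k′ , AllWithin-mono k≤k′ σ σ≤k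

  AllWithin⇒headSize≤ : ∀ {k} (σ : Segments x y) → AllWithin k σ → headSize σ ≤ k
  AllWithin⇒headSize≤ [ P ]          P≤k       = P≤k
  AllWithin⇒headSize≤ (P ∷⟨ _ ⟩ σ) (P≤k , _) = P≤k

  AllWithin⇒lastSize≤ : ∀ {k} (σ : Segments x y) → AllWithin k σ → lastSize σ ≤ k
  AllWithin⇒lastSize≤ [ P ]          P≤k       = P≤k
  AllWithin⇒lastSize≤ (P ∷⟨ _ ⟩ σ) (_ , σ≤k) = AllWithin⇒lastSize≤ σ σ≤k

  AllWithin-++ˢ : ∀ {k} (σ : Segments x y) (τ : Segments y z) → AllWithin k σ → AllWithin k τ →
                  lastSize σ + headSize τ ≤ k → AllWithin k (σ ++ˢ τ)
  AllWithin-++ˢ [ P ]          [ Q ]          _           _         PQ≤k = size-++ᵖ-≤ P Q PQ≤k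
  AllWithin-++ˢ [ P ]          (Q ∷⟨ _ ⟩ τ) _           (_ , τ≤k) PQ≤k = size-++ᵖ-≤ P Q PQ≤k , τ≤k
  AllWithin-++ˢ (P ∷⟨ _ ⟩ σ) τ              (P≤k , σ≤k) τ≤k       PQ≤k = P≤k , AllWithin-++ˢ σ τ σ≤k τ≤k PQ≤k

  headSize-++ˢ : ∀ {k} (σ : Segments x y) (τ : Segments y z) → headSize σ ≤ k →
                 (IsSingle σ → headSize σ + headSize τ ≤ k) → headSize (σ ++ˢ τ) ≤ k
  headSize-++ˢ [ P ]          [ Q ]          _   PQ≤k = size-++ᵖ-≤ P Q (PQ≤k tt)
  headSize-++ˢ [ P ]          (Q ∷⟨ _ ⟩ _) _   PQ≤k = size-++ᵖ-≤ P Q (PQ≤k tt)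
  headSize-++ˢ (P ∷⟨ _ ⟩ _) _              P≤k _    = P≤k

  lastSize-++ˢ : ∀ {k} (σ : Segments x y) (τ : Segments y z) → lastSize τ ≤ k →
                 (IsSingle τ → lastSize σ + lastSize τ ≤ k) → lastSize (σ ++ˢ τ) ≤ k
  lastSize-++ˢ [ P ]          [ Q ]          _   PQ≤k = size-++ᵖ-≤ P Q (PQ≤k tt)
  lastSize-++ˢ [ _ ]          (_ ∷⟨ _ ⟩ _) τ≤k _    = τ≤k
  lastSize-++ˢ (_ ∷⟨ _ ⟩ σ) τ              τ≤k PQ≤k = lastSize-++ˢ σ τ τ≤k PQ≤k

  AllWithin⇒Covered : ∀ {k} (σ : Segments x y) → AllWithin k σ → Covered B k (concat σ)
  AllWithin⇒Covered [ P ]          P≤k         = last P P≤k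
  AllWithin⇒Covered (P ∷⟨ b ⟩ σ) (P≤k , σ≤k) = more P (concat σ) P≤k b (AllWithin⇒Covered σ σ≤k)

module TreePaths {n : ℕ} {G : Graph n} {s : Fin n} (T : OutTree G s) where

  private variable x y z w : Fin n

  asPath : TPath T x y → Path G x y
  asPath (here _)           = []
  asPath (down {e = e} t _) = asPath t ++ᵖ (e ∷ [])

  len-asPath : (t : TPath T x y) → len (asPath t) ≡ tlen t
  len-asPath (here _)                   = refl
  len-asPath (down {w = w} {e = e} t _) =
    trans (len-++ᵖ (asPath t) (e ∷ [])) (cong₂ ℚ._+_ (len-asPath t) (ℚₚ.+-identityʳ w))

  depth-asPath : (t : TPath T x y) → depth T y ≡ depth T x + size (asPath t)
  depth-asPath {x} (here _) = sym (+-identityʳ (depth T x))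
  depth-asPath {x} (down {u = u} {v} {w} {e} t par≡) = begin
    depth T v                                ≡⟨ par-depth T v u w e par≡ ⟩
    suc (depth T u)                          ≡⟨ cong suc (depth-asPath t) ⟩
    suc (depth T x + size (asPath t))        ≡⟨ sym (+-suc (depth T x) _) ⟩
    depth T x + suc (size (asPath t))        ≡⟨ cong (depth T x +_) (+-comm 1 (size (asPath t))) ⟩
    depth T x + (size (asPath t) + 1)        ≡⟨ cong (depth T x +_) (sym (size-++ᵖ (asPath t) (e ∷ []))) ⟩
    depth T x + size (asPath t ++ᵖ (e ∷ [])) ∎
    where open ≡-Reasoning

  depth-≤ : TPath T x y → depth T x ≤ depth T y
  depth-≤ {x} t = subst (depth T x ≤_) (sym (depth-asPath t)) (m≤m+n _ _)

  size-asPath≤ : ∀ {k} (t : TPath T x y) → depth T y ≤ depth T x + k → size (asPath t) ≤ k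
  size-asPath≤ {x} {k = k} t y≤x+k =
    +-cancelˡ-≤ (depth T x) _ _ (subst (_≤ depth T x + k) (depth-asPath t) y≤x+k)

  InT-top : TPath T x y → InT T x
  InT-top (here x∈T) = x∈T
  InT-top (down t _) = InT-top t

  InT-bottom : TPath T x y → InT T y
  InT-bottom (here y∈T)                        = y∈T
  InT-bottom (down {u = u} {w = w} {e} _ par≡) = inj₂ ((u , w , e) , par≡)

  NonLeaf-top : (t : TPath T x y) → depth T x < depth T y → NonLeaf T x
  NonLeaf-top (here _)             x<x = ⊥-elim (<-irrefl refl x<x)
  NonLeaf-top (down (here _) par≡) _   = _ , _ , _ , par≡
  NonLeaf-top {x} (down (down {u = u′} {u} {w′} {e′} t par≡′) _) _ =
    NonLeaf-top (down t par≡′) (subst (depth T x <_) (sym (par-depth T u u′ w′ e′ par≡′)) (s≤s (depth-≤ t)))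

  infixl 5 _⊙_

  _⊙_ : TPath T x y → TPath T y z → TPath T x z
  t ⊙ here _      = t
  t ⊙ down u par≡ = down (t ⊙ u) par≡

  asPath-⊙ : (t : TPath T x y) (u : TPath T y z) → asPath (t ⊙ u) ≡ asPath t ++ᵖ asPath u
  asPath-⊙ t (here _)           = sym (++ᵖ-identityʳ (asPath t))
  asPath-⊙ t (down {e = e} u _) =
    trans (cong (_++ᵖ (e ∷ [])) (asPath-⊙ t u)) (++ᵖ-assoc (asPath t) (asPath u) (e ∷ []))

  record Split (t : TPath T x y) (z : Fin n) : Set where
    constructor split
    field
      before : TPath T x z
      after  : TPath T z y
      joins  : asPath before ++ᵖ asPath after ≡ asPath t
  open Split public

  split-end : (t : TPath T x y) → Split t y
  split-end t = split t (here (InT-bottom t)) (++ᵖ-identityʳ (asPath t))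

  split-down : ∀ {u v w e} {t : TPath T x u} {par≡ : par T v ≡ just (u , w , e)} →
               Split t z → Split (down t par≡) z
  split-down {e = e} {par≡ = par≡} (split t₁ t₂ joins) = split t₁ (down t₂ par≡)
    (trans (sym (++ᵖ-assoc (asPath t₁) (asPath t₂) (e ∷ []))) (cong (_++ᵖ (e ∷ [])) joins))

  splitAtDepth : (t : TPath T x y) (i : ℕ) → depth T x ≤ i → i ≤ depth T y →
                 Σ (Fin n) λ z → depth T z ≡ i × Split t z
  splitAtDepth (here x∈T) i x≤i i≤x = _ , ≤-antisym x≤i i≤x , split-end (here x∈T)
  splitAtDepth t@(down {u = u} {v} {w} {e} t′ par≡) i x≤i i≤v with i ≟ depth T v
  ... | yes i≡v = v , sym i≡v , split-end t
  ... | no  i≢v with splitAtDepth t′ i x≤i i≤u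
    where
    i≤u : i ≤ depth T u
    i≤u = ≤-pred (subst (i <_) (par-depth T v u w e par≡) (≤∧≢⇒< i≤v i≢v))
  ... | z , z≡i , σ = z , z≡i , split-down σ

  splitAtVertex : (t : TPath T x y) → z ∈ˡ verts t → Split t z
  splitAtVertex t@(here _)   (here refl) = split-end t
  splitAtVertex t@(down _ _) (here refl) = split-end t
  splitAtVertex (down t _)   (there z∈t) = split-down (splitAtVertex t z∈t)

  refineAfter : {t : TPath T x y} (σ : Split t z) → Split (after σ) w → Split t w
  refineAfter {t = t} (split t₁ t₂ joins) (split u₁ u₂ joins′) = split (t₁ ⊙ u₁) u₂ (begin
    asPath (t₁ ⊙ u₁) ++ᵖ asPath u₂           ≡⟨ cong (_++ᵖ asPath u₂) (asPath-⊙ t₁ u₁) ⟩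
    (asPath t₁ ++ᵖ asPath u₁) ++ᵖ asPath u₂  ≡⟨ ++ᵖ-assoc (asPath t₁) (asPath u₁) (asPath u₂) ⟩
    asPath t₁ ++ᵖ (asPath u₁ ++ᵖ asPath u₂)  ≡⟨ cong (asPath t₁ ++ᵖ_) joins′ ⟩
    asPath t₁ ++ᵖ asPath t₂                  ≡⟨ joins ⟩
    asPath t                                 ∎)
    where open ≡-Reasoning

  refineBefore : {t : TPath T x y} (σ : Split t z) → Split (before σ) w → Split t w
  refineBefore {t = t} (split t₁ t₂ joins) (split u₁ u₂ joins′) = split u₁ (u₂ ⊙ t₂) (begin
    asPath u₁ ++ᵖ asPath (u₂ ⊙ t₂)           ≡⟨ cong (asPath u₁ ++ᵖ_) (asPath-⊙ u₂ t₂) ⟩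
    asPath u₁ ++ᵖ (asPath u₂ ++ᵖ asPath t₂)  ≡⟨ sym (++ᵖ-assoc (asPath u₁) (asPath u₂) (asPath t₂)) ⟩
    (asPath u₁ ++ᵖ asPath u₂) ++ᵖ asPath t₂  ≡⟨ cong (_++ᵖ asPath t₂) joins′ ⟩
    asPath t₁ ++ᵖ asPath t₂                  ≡⟨ joins ⟩
    asPath t                                 ∎)
    where open ≡-Reasoning

  module _ {k : ℕ} {B : Subset n} (1≤k : 1 ≤ k) (blocks : IsBlocker T k B) where
    open Segmentation G B

    blockerInWindow : ∀ {i} (t : TPath T x y) → k ∣ i → depth T x ≤ i → i + k ≤ depth T y →
                      Σ (Fin n) λ z → z ∈ B × i ≤ depth T z × depth T z ≤ i + k × Split t z
    blockerInWindow {i = i} t k∣i x≤i i+k≤y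
      with splitAtDepth t i x≤i (≤-trans (m≤m+n i k) i+k≤y)
    ... | a , a≡i , σ₁ with splitAtDepth (after σ₁) (i + k) (≤-trans (≤-reflexive a≡i) (m≤m+n i k)) i+k≤y
    ... | b , b≡i+k , σ₂ with blocks a b (InT-top window) (NonLeaf-top window a<b) (subst (k ∣_) (sym a≡i) k∣i)
                                      window (trans b≡i+k (cong (_+ k) (sym a≡i)))
      where
      window = before σ₂
      a<b : depth T a < depth T b
      a<b = subst₂ _<_ (sym a≡i) (sym b≡i+k) (m<m+n i 1≤k)
    ... | z , z∈window , z∈B =
      z , z∈B , ≤-trans (≤-reflexive (sym a≡i)) (depth-≤ (before σ₃)) ,
      ≤-trans (depth-≤ (after σ₃)) (≤-reflexive b≡i+k) , refineAfter σ₁ (refineBefore σ₂ σ₃)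
      where σ₃ = splitAtVertex (before σ₂) z∈window

    Segmented : TPath T x y → Set
    Segmented {x} {y} t = Σ (Segments x y) λ σ → concat σ ≡ asPath t × AllWithin (k + k) σ

    private
      i+k≤x+2k : ∀ {i m} → i ≤ m + k → i + k ≤ m + (k + k)
      i+k≤x+2k i≤m+k = ≤-trans (+-monoˡ-≤ k i≤m+k) (≤-reflexive (+-assoc _ k k))

    -- fuel bounds the number of windows [i, i + k], [i + k, i + 2k], … that t still reaches into.
    segmentedFrom : ∀ fuel i (t : TPath T x y) → k ∣ i → depth T x ≤ i → i ≤ depth T x + k →
                    depth T y ≤ i + fuel * k → Segmented t
    segmentedFrom zero i t _ _ i≤x+k y≤i+0 =
      [ asPath t ] , refl , size-asPath≤ t (≤-trans y≤i+0 (≤-trans (+-monoʳ-≤ i z≤n) (i+k≤x+2k i≤x+k)))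
    segmentedFrom {y = y} (suc fuel) i t k∣i x≤i i≤x+k y≤ with depth T y ≤? i + k
    ... | yes y≤i+k = [ asPath t ] , refl , size-asPath≤ t (≤-trans y≤i+k (i+k≤x+2k i≤x+k))
    ... | no  y≰i+k with blockerInWindow t k∣i x≤i (<⇒≤ (≰⇒> y≰i+k))
    ... | z , z∈B , i≤z , z≤i+k , split t₁ t₂ joins
      with segmentedFrom fuel (i + k) t₂ (∣m∣n⇒∣m+n k∣i ∣-refl) z≤i+k (+-monoˡ-≤ k i≤z)
                         (≤-trans y≤ (≤-reflexive (sym (+-assoc i k (fuel * k)))))
    ... | σ , concat≡ , σ≤2k =
      asPath t₁ ∷⟨ z∈B ⟩ σ , trans (cong (asPath t₁ ++ᵖ_) concat≡) joins ,
      size-asPath≤ t₁ (≤-trans z≤i+k (i+k≤x+2k i≤x+k)) , σ≤2k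

    segmentedFromRoot : (t : TPath T s y) → Segmented t
    segmentedFromRoot {y} t =
      segmentedFrom (depth T y) 0 t (divides 0 refl) (≤-reflexive (depth-root T)) z≤n (m≤m*n (depth T y) k)
      where instance _ = >-nonZero 1≤k

module HubChains {n : ℕ} {G : Graph n} (pos : PositiveWeights G) (H : Subset n) (d : ℕ) where

  private variable a b c : Fin n

  data Chain : Fin n → Fin n → ℕ → Set where
    []   : Chain a a 0
    cons : ∀ {m} → a ∈ H → (P : Path G a b) → size P ≤ d → Chain b c m → Chain a c (suc m)

  weight : ∀ {m} → Chain a c m → ℚ
  weight []             = 0ℚ
  weight (cons _ P _ r) = len P ℚ.+ weight r

  weight-nonNeg : ∀ {m} (ch : Chain a c m) → 0ℚ ℚ.≤ weight ch
  weight-nonNeg []             = ℚₚ.≤-refl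
  weight-nonNeg (cons _ P _ r) = ℚₚ.+-mono-≤ (len-nonNeg pos P) (weight-nonNeg r)

  hubs : ∀ {m} → Chain a c m → List (Fin n)
  hubs []                 = []
  hubs (cons {a} _ _ _ r) = a ∷ hubs r

  length-hubs : ∀ {m} (ch : Chain a c m) → length (hubs ch) ≡ m
  length-hubs []             = refl
  length-hubs (cons _ _ _ r) = cong suc (length-hubs r)

  chainOfCovered : ∀ {Q : Path G a c} → a ∈ H → Covered H d Q →
                   Σ ℕ λ m → Σ (Chain a c m) λ ch → weight ch ≡ len Q
  chainOfCovered a∈H (last P P≤d) = 1 , cons a∈H P P≤d [] , ℚₚ.+-identityʳ (len P)
  chainOfCovered a∈H (more P Q P≤d b∈H cov) with chainOfCovered b∈H cov
  ... | m , ch , weight≡ = suc m , cons a∈H P P≤d ch , trans (cong (len P ℚ.+_) weight≡) (sym (len-++ᵖ P Q))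

  splitChain : ∀ m₁ {m} → m₁ ≤ m → (ch : Chain a c m) →
               Σ (Fin n) λ b → Σ (Chain a b m₁) λ ch₁ → Σ (Chain b c (m ∸ m₁)) λ ch₂ →
               weight ch ≡ weight ch₁ ℚ.+ weight ch₂
  splitChain zero     _          ch                 = _ , [] , ch , sym (ℚₚ.+-identityˡ (weight ch))
  splitChain (suc m₁) (s≤s m₁≤m) (cons a∈H P P≤d r) with splitChain m₁ m₁≤m r
  ... | b , ch₁ , ch₂ , weight≡ =
    b , cons a∈H P P≤d ch₁ , ch₂ , trans (cong (len P ℚ.+_) weight≡) (sym (ℚₚ.+-assoc (len P) _ _))

  record SimpleChain (a c : Fin n) (ℓ : ℚ) : Set where
    constructor simple
    field
      {hops}  : ℕ
      chain   : Chain a c hops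
      unique  : Unique (hubs chain)
      weight≤ : weight chain ℚ.≤ ℓ

  weaken : ∀ {ℓ ℓ′} → ℓ ℚ.≤ ℓ′ → SimpleChain a c ℓ → SimpleChain a c ℓ′
  weaken ℓ≤ℓ′ (simple ch unique weight≤) = simple ch unique (ℚₚ.≤-trans weight≤ ℓ≤ℓ′)

  suffixFrom : ∀ {m} (ch : Chain b c m) → a ∈ˡ hubs ch → Unique (hubs ch) → SimpleChain a c (weight ch)
  suffixFrom ch@(cons _ _ _ _) (here refl) unique       = simple ch unique ℚₚ.≤-refl
  suffixFrom (cons _ P _ r)    (there a∈r) (_ ∷ unique) = weaken (p≤q+p (len-nonNeg pos P)) (suffixFrom r a∈r unique)

  simplify : ∀ {m} (ch : Chain a c m) → SimpleChain a c (weight ch)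
  simplify []                      = simple [] [] ℚₚ.≤-refl
  simplify {a} (cons a∈H P P≤d r) with simplify r
  ... | simple r′ unique weight≤ with any? (a ≟ᶠ_) (hubs r′)
  ...   | yes a∈r′ = weaken (ℚₚ.≤-trans weight≤ (p≤q+p (len-nonNeg pos P))) (suffixFrom r′ a∈r′ unique)
  ...   | no  a∉r′ = simple (cons a∈H P P≤d r′) (¬Any⇒All¬ (hubs r′) a∉r′ ∷ unique) (ℚₚ.+-monoʳ-≤ (len P) weight≤)

  hops≤n : ∀ {ℓ} (sc : SimpleChain a c ℓ) → SimpleChain.hops sc ≤ n
  hops≤n (simple ch unique _) = subst (_≤ n) (length-hubs ch) (Unique⇒length≤ unique)

module Stitching {n : ℕ} {G : Graph n} (pos : PositiveWeights G) {ε : ℚ} (0≤ε : 0ℚ ℚ.≤ ε)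
                 {H B : Subset n} {k d : ℕ} (1≤k : 1 ≤ k) (k+k≡d : k + k ≡ d)
                 (Tfrom : ∀ v → v ∈ H → OutTree G v)
                 (spt : ∀ v (v∈H : v ∈ H) → IsApproxSPT ε (3 * d) (Tfrom v v∈H))
                 (blocks : ∀ v (v∈H : v ∈ H) → IsBlocker (Tfrom v v∈H) k B) where

  open Segmentation G B
  open HubChains pos H d
  open TreePaths using (asPath; len-asPath; segmentedFromRoot)

  private variable a b c x y : Fin n

  α : ℚ
  α = 1ℚ ℚ.+ ε

  1≤α : 1ℚ ℚ.≤ α
  1≤α = ℚₚ.≤-trans (ℚₚ.≤-reflexive (sym (ℚₚ.+-identityʳ 1ℚ))) (ℚₚ.+-monoʳ-≤ 1ℚ 0≤ε)

  treeShortcut : a ∈ H → (P : Path G a c) → size P ≤ 3 * d →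
                 Σ (Segments a c) λ σ → AllWithin d σ × len (concat σ) ℚ.≤ α ℚ.* len P
  treeShortcut {a} {c} a∈H P P≤3d with spt a a∈H c (P , P≤3d)
  ... | _ , t , t≤ with segmentedFromRoot (Tfrom a a∈H) 1≤k (blocks a a∈H) t
  ... | σ , concat≡ , σ≤2k = σ , subst (λ m → AllWithin m σ) k+k≡d σ≤2k , (begin
    len (concat σ)                ≡⟨ cong len concat≡ ⟩
    len (asPath (Tfrom a a∈H) t)  ≡⟨ len-asPath (Tfrom a a∈H) t ⟩
    tlen t                        ≤⟨ t≤ P P≤3d ⟩
    α ℚ.* len P                   ∎)
    where open ℚₚ.≤-Reasoning

  -- single≤ keeps an unsplit segmentation short enough for two of them to fit a depth-3d tree.
  record Balanced (h : ℕ) (σ : Segments x y) : Set where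
    constructor balanced
    field
      pieces≤ : AllWithin (h + h) σ
      head≤   : headSize σ ≤ h
      last≤   : lastSize σ ≤ h
      single≤ : IsSingle σ → AllWithin d σ

  AllWithin⇒Balanced : ∀ {h} → d ≤ h → (σ : Segments x y) → AllWithin d σ → Balanced h σ
  AllWithin⇒Balanced {h = h} d≤h σ σ≤d = balanced
    (AllWithin-mono (≤-trans d≤h (m≤m+n h h)) σ σ≤d)
    (≤-trans (AllWithin⇒headSize≤ σ σ≤d) d≤h)
    (≤-trans (AllWithin⇒lastSize≤ σ σ≤d) d≤h)
    (λ _ → σ≤d)

  Balanced-++ˢ : ∀ {h} (σ : Segments x y) (τ : Segments y c) → ¬ (IsSingle σ × IsSingle τ) →
                 Balanced h σ → Balanced h τ → Balanced (d + h) (σ ++ˢ τ)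
  Balanced-++ˢ {h = h} σ τ notBoth (balanced σ≤ σ-head σ-last σ-single) (balanced τ≤ τ-head τ-last τ-single) =
    balanced
      (AllWithin-++ˢ σ τ (AllWithin-mono h+h≤ σ σ≤) (AllWithin-mono h+h≤ τ τ≤)
                         (≤-trans (+-mono-≤ σ-last τ-head) h+h≤))
      (headSize-++ˢ σ τ (≤-trans σ-head (m≤n+m h d))
                    (λ single → +-mono-≤ (AllWithin⇒headSize≤ σ (σ-single single)) τ-head))
      (lastSize-++ˢ σ τ (≤-trans τ-last (m≤n+m h d))
                    (λ single → ≤-trans (+-mono-≤ σ-last (AllWithin⇒lastSize≤ τ (τ-single single)))
                                        (≤-reflexive (+-comm h d))))
      (λ single → ⊥-elim (notBoth (IsSingle-++ˢ σ τ single)))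
    where
    h+h≤ : h + h ≤ (d + h) + (d + h)
    h+h≤ = +-mono-≤ (m≤n+m h d) (m≤n+m h d)

  record Stitched (j : ℕ) (a c : Fin n) (ℓ : ℚ) : Set where
    constructor stitched
    field
      segments : Segments a c
      balance  : Balanced (suc j * d) segments
      len≤     : len (concat segments) ℚ.≤ α ^ℚ j ℚ.* ℓ

  mergeByTree : ∀ {j ℓ₁ ℓ₂} → a ∈ H → (P₁ : Path G a b) (P₂ : Path G b c) → size P₁ ≤ d → size P₂ ≤ d →
                len P₁ ℚ.≤ α ^ℚ j ℚ.* ℓ₁ → len P₂ ℚ.≤ α ^ℚ j ℚ.* ℓ₂ → Stitched (suc j) a c (ℓ₁ ℚ.+ ℓ₂)
  mergeByTree {j = j} {ℓ₁} {ℓ₂} a∈H P₁ P₂ P₁≤d P₂≤d P₁≤ P₂≤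
    with treeShortcut a∈H (P₁ ++ᵖ P₂) (size-++ᵖ-≤ P₁ P₂ (≤-trans (+-mono-≤ P₁≤d P₂≤d) (+-monoʳ-≤ d (m≤m+n d _))))
  ... | σ , σ≤d , σ≤ = stitched σ (AllWithin⇒Balanced (m≤m+n d _) σ σ≤d) (begin
    len (concat σ)                  ≤⟨ σ≤ ⟩
    α ℚ.* len (P₁ ++ᵖ P₂)           ≡⟨ cong (α ℚ.*_) (len-++ᵖ P₁ P₂) ⟩
    α ℚ.* (len P₁ ℚ.+ len P₂)       ≤⟨ *-monoˡ-≤-nonNeg α (1≤p⇒0≤p 1≤α) (+-mono-*ˡ-≤ (α ^ℚ j) P₁≤ P₂≤) ⟩
    α ℚ.* (α ^ℚ j ℚ.* (ℓ₁ ℚ.+ ℓ₂))  ≡⟨ sym (ℚₚ.*-assoc α (α ^ℚ j) _) ⟩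
    α ^ℚ suc j ℚ.* (ℓ₁ ℚ.+ ℓ₂)      ∎)
    where open ℚₚ.≤-Reasoning

  mergeByConcat : ∀ {j ℓ₁ ℓ₂} → 0ℚ ℚ.≤ ℓ₁ ℚ.+ ℓ₂ → (s₁ : Stitched j a b ℓ₁) (s₂ : Stitched j b c ℓ₂) →
                  ¬ (IsSingle (Stitched.segments s₁) × IsSingle (Stitched.segments s₂)) →
                  Stitched (suc j) a c (ℓ₁ ℚ.+ ℓ₂)
  mergeByConcat {j = j} {ℓ₁} {ℓ₂} 0≤ℓ (stitched σ σ-bal σ≤) (stitched τ τ-bal τ≤) notBoth =
    stitched (σ ++ˢ τ) (Balanced-++ˢ σ τ notBoth σ-bal τ-bal) (begin
      len (concat (σ ++ˢ τ))             ≡⟨ cong len (concat-++ˢ σ τ) ⟩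
      len (concat σ ++ᵖ concat τ)        ≡⟨ len-++ᵖ (concat σ) (concat τ) ⟩
      len (concat σ) ℚ.+ len (concat τ)  ≤⟨ +-mono-*ˡ-≤ (α ^ℚ j) σ≤ τ≤ ⟩
      α ^ℚ j ℚ.* (ℓ₁ ℚ.+ ℓ₂)             ≤⟨ ^ℚ-monoˡ-* 1≤α 0≤ℓ (n≤1+n j) ⟩
      α ^ℚ suc j ℚ.* (ℓ₁ ℚ.+ ℓ₂)         ∎)
    where open ℚₚ.≤-Reasoning

  merge : ∀ {j ℓ₁ ℓ₂} → a ∈ H → 0ℚ ℚ.≤ ℓ₁ ℚ.+ ℓ₂ → Stitched j a b ℓ₁ → Stitched j b c ℓ₂ →
          Stitched (suc j) a c (ℓ₁ ℚ.+ ℓ₂)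
  merge a∈H _ (stitched [ P₁ ] σ-bal σ≤) (stitched [ P₂ ] τ-bal τ≤) =
    mergeByTree a∈H P₁ P₂ (Balanced.single≤ σ-bal tt) (Balanced.single≤ τ-bal tt) σ≤ τ≤
  merge _ 0≤ℓ s₁@(stitched [ _ ] _ _)          s₂@(stitched (_ ∷⟨ _ ⟩ _) _ _) =
    mergeByConcat 0≤ℓ s₁ s₂ λ { (_ , ()) }
  merge _ 0≤ℓ s₁@(stitched (_ ∷⟨ _ ⟩ _) _ _) s₂ =
    mergeByConcat 0≤ℓ s₁ s₂ λ { (() , _) }

  stitch : ∀ j {m} (ch : Chain a c m) → m ≤ 2 ^ j → Stitched j a c (weight ch)
  stitch j [] _ =
    stitched [ [] ] (AllWithin⇒Balanced (m≤m+n d _) [ [] ] z≤n) (ℚₚ.≤-reflexive (sym (ℚₚ.*-zeroʳ (α ^ℚ j))))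
  stitch zero (cons _ P P≤d []) _ =
    stitched [ P ] (AllWithin⇒Balanced (m≤m+n d 0) [ P ] P≤d)
             (ℚₚ.≤-reflexive (sym (trans (ℚₚ.*-identityˡ _) (ℚₚ.+-identityʳ (len P)))))
  stitch zero (cons _ _ _ (cons _ _ _ _)) (s≤s ())
  stitch (suc j) {m} ch@(cons a∈H _ _ _) m≤2^j+1
    with halve m (2 ^ j) (≤-trans m≤2^j+1 (≤-reflexive (cong (2 ^ j +_) (+-identityʳ (2 ^ j)))))
  ... | m₁ , m₁≤m , m₁≤2^j , m₂≤2^j with splitChain m₁ m₁≤m ch
  ... | _ , ch₁ , ch₂ , weight≡ =
    subst (Stitched (suc j) _ _) (sym weight≡)
      (merge a∈H (subst (0ℚ ℚ.≤_) weight≡ (weight-nonNeg ch)) (stitch j ch₁ m₁≤2^j) (stitch j ch₂ m₂≤2^j))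

  prepend : ∀ {u m v ℓ} L (P₀ : Path G u m) → size P₀ ≤ d → Stitched L m v ℓ →
            Σ (Path G u v) λ R → Covered B (suc L * d + suc L * d) R × len R ℚ.≤ α ^ℚ L ℚ.* (len P₀ ℚ.+ ℓ)
  prepend L P₀ P₀≤d (stitched σ (balanced σ≤ σ-head _ _) σ-len) =
    concat ([ P₀ ] ++ˢ σ) ,
    AllWithin⇒Covered ([ P₀ ] ++ˢ σ)
      (AllWithin-++ˢ [ P₀ ] σ (≤-trans P₀≤d (≤-trans d≤h (m≤m+n h h))) σ≤ (+-mono-≤ (≤-trans P₀≤d d≤h) σ-head)) ,
    ℚₚ.≤-trans (ℚₚ.≤-reflexive (trans (cong len (concat-++ˢ [ P₀ ] σ)) (len-++ᵖ P₀ (concat σ))))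
               (+-mono-*ˡ-≤ (α ^ℚ L) (p≤r*p (1≤^ℚ 1≤α L) (len-nonNeg pos P₀)) σ-len)
    where
    h = suc L * d
    d≤h : d ≤ h
    d≤h = m≤m+n d (L * d)

  hubSetOfBlockers : ∀ q L → IsApproxHubSet G (α ^ℚ q) d H → n ≤ 2 ^ L →
                     IsApproxHubSet G (α ^ℚ (L + q)) (suc L * d + suc L * d) B
  hubSetOfBlockers q L hub n≤2^L u v u⇝v with hub u v u⇝v
  ... | Q , last .Q Q≤d , Q≤ =
    Q , last Q (≤-trans Q≤d (≤-trans (m≤m+n d (L * d)) (m≤m+n _ _))) ,
    λ P → ℚₚ.≤-trans (Q≤ P) (^ℚ-monoˡ-* 1≤α (len-nonNeg pos P) (m≤n+m q L))
  ... | .(P₀ ++ᵖ Q) , more P₀ Q P₀≤d m∈H cov , P₀Q≤ with chainOfCovered m∈H cov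
  ... | _ , ch , weight≡ with simplify ch
  ... | sc@(simple ch′ _ ch′≤) with prepend L P₀ P₀≤d (stitch L ch′ (≤-trans (hops≤n sc) n≤2^L))
  ... | R , R-covered , R≤ = R , R-covered , λ P → begin
    len R                               ≤⟨ R≤ ⟩
    α ^ℚ L ℚ.* (len P₀ ℚ.+ weight ch′)  ≤⟨ *-monoˡ-≤-nonNeg (α ^ℚ L) (0≤^ℚ 1≤α L)
                                             (ℚₚ.+-monoʳ-≤ (len P₀) (ℚₚ.≤-trans ch′≤ (ℚₚ.≤-reflexive weight≡))) ⟩
    α ^ℚ L ℚ.* (len P₀ ℚ.+ len Q)       ≡⟨ cong (α ^ℚ L ℚ.*_) (sym (len-++ᵖ P₀ Q)) ⟩
    α ^ℚ L ℚ.* len (P₀ ++ᵖ Q)           ≤⟨ *-monoˡ-≤-nonNeg (α ^ℚ L) (0≤^ℚ 1≤α L) (P₀Q≤ P) ⟩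
    α ^ℚ L ℚ.* (α ^ℚ q ℚ.* len P)       ≡⟨ sym (ℚₚ.*-assoc (α ^ℚ L) (α ^ℚ q) (len P)) ⟩
    α ^ℚ L ℚ.* α ^ℚ q ℚ.* len P         ≡⟨ cong (ℚ._* len P) (sym (^ℚ-distribˡ-+-* α L q)) ⟩
    α ^ℚ (L + q) ℚ.* len P              ∎
    where open ℚₚ.≤-Reasoning

mainTheorem19 : ∀ (n : ℕ) (G : Graph n) → PositiveWeights G →
    (ε : ℚ) → 0ℚ ℚ.≤ ε →
    (d : ℕ) → 0 < d → 2 ∣ d →
    (q : ℕ) (H : Subset n) → IsApproxHubSet G ((1ℚ ℚ.+ ε) ^ℚ q) d H →
    (Tfrom : ∀ v → v ∈ H → OutTree G v) →
    (∀ v (h : v ∈ H) → IsApproxSPT ε (3 * d) (Tfrom v h)) →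
    (Tto : ∀ v → v ∈ H → OutTree (rev G) v) →
    (∀ v (h : v ∈ H) → IsApproxSPT ε (3 * d) (Tto v h)) →
    (B : Subset n) →
    (∀ v (h : v ∈ H) → IsBlocker (Tfrom v h) (d / 2) B × IsBlocker (Tto v h) (d / 2) B) →
    let p = ⌈log₂ n ⌉ + 1 in
    IsApproxHubSet G ((1ℚ ℚ.+ ε) ^ℚ (p + q ∸ 1)) (2 * d * p) B
mainTheorem19 n G pos ε 0≤ε d 0<d 2∣d q H hub Tfrom sptFrom _ _ B blocks =
  subst₂ (λ e K → IsApproxHubSet G ((1ℚ ℚ.+ ε) ^ℚ e) K B) exponent≡ bound≡
    (Stitching.hubSetOfBlockers pos 0≤ε 1≤k k+k≡d Tfrom sptFrom (λ v v∈H → proj₁ (blocks v v∈H))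
                                q L hub (n≤2^⌈log₂n⌉ n))
  where
  L = ⌈log₂ n ⌉
  k = d / 2
  k+k≡d : k + k ≡ d
  k+k≡d = trans (cong (k +_) (sym (+-identityʳ k))) (trans (*-comm 2 k) (m/n*n≡m 2∣d))
  1≤k : 1 ≤ k
  1≤k = n≢0⇒n>0 λ k≡0 → <⇒≢ 0<d (sym (trans (sym k+k≡d) (cong (λ m → m + m) k≡0)))
  exponent≡ : L + q ≡ L + 1 + q ∸ 1
  exponent≡ = sym (cong (_∸ 1) (trans (+-assoc L 1 q) (+-suc L q)))
  bound≡ : suc L * d + suc L * d ≡ 2 * d * (L + 1)
  bound≡ = solve 2 (λ L d → (con 1 :+ L) :* d :+ (con 1 :+ L) :* d := con 2 :* d :* (L :+ con 1)) refl L d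
    where open +-*-Solver
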